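{- Let $0<\varepsilon<1$ and let $G$ be a finite graph. Then $G$ has a unit grid intersection representation in which every segment is contained in an open axis-parallel square of side length $1+\varepsilon$ if and only if $G$ is an orthogonal ray graph.
   Context: A grid intersection representation of a bipartite graph $G$ with bipartition $(H,V)$ assigns to each vertex of $H$ a horizontal closed line segment and to each vertex of $V$ a vertical closed line segment in the plane, such that no two horizontal segments intersect, no two vertical segments intersect, and for $u\in H$, $v\in V$ the segments of $u$ and $v$ intersect if and only if $uv\in E(G)$. It is a unit grid intersection representation if all segments have length $1$; graphs admitting one are unit grid intersection graphs (UGIGs). An orthogonal ray graph is a bipartite graph admitting a representation of the same kind in which the horizontal and vertical segments are replaced by horizontal and vertical closed rays (half-lines), each ray pointing in any of the two directions along its axis.
   Formalization: The plane is taken as ℚ², so all segments, rays and the enclosing open square have rational coordinates, and the parameter ε ranges over the rationals with $0<\varepsilon<1$. -}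

module Defs where

open import Data.Nat using (ℕ)
open import Data.Fin using (Fin)
open import Data.Bool using (Bool; true; false)
open import Data.Rational using (ℚ; _≤_; _<_; _+_; _-_; 1ℚ)
open import Data.Product using (Σ; ∃; _×_; _,_)
open import Relation.Nullary using (¬_)
open import Relation.Binary.PropositionalEquality using (_≡_; _≢_)

record Point : Set where
  constructor ⟨_,_⟩
  field
    px : ℚ
    py : ℚ
open Point public

record Graph : Set₁ where
  field
    n     : ℕ
    Adj   : Fin n → Fin n → Set
    sym   : ∀ {u v} → Adj u v → Adj v u
    irrefl : ∀ {u} → ¬ Adj u u
open Graph public

data Orient : Set where
  hor ver : Orient

along : Orient → Point → ℚ
along hor p = px p
along ver p = py p

across : Orient → Point → ℚ
across hor p = py p
across ver p = px p

record Segment : Set where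
  field
    sOrient : Orient
    sLevel  : ℚ
    lo hi   : ℚ
    lo≤hi   : lo ≤ hi
open Segment public

_∈Seg_ : Point → Segment → Set
p ∈Seg s = (across (sOrient s) p ≡ sLevel s)
         × (lo s ≤ along (sOrient s) p) × (along (sOrient s) p ≤ hi s)

length : Segment → ℚ
length s = hi s - lo s

record Ray : Set where
  field
    rOrient : Orient
    rLevel  : ℚ
    start   : ℚ
    positive : Bool
open Ray public

_∈Ray_ : Point → Ray → Set
p ∈Ray r with positive r
... | true  = (across (rOrient r) p ≡ rLevel r) × (start r ≤ along (rOrient r) p)
... | false = (across (rOrient r) p ≡ rLevel r) × (along (rOrient r) p ≤ start r)

module _ {Obj : Set} (orient : Obj → Orient) (_∈_ : Point → Obj → Set) where

  Meet : Obj → Obj → Set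
  Meet a b = ∃ λ p → (p ∈ a) × (p ∈ b)

  IsRep : (G : Graph) → (Fin (n G) → Obj) → Set
  IsRep G f =
      (∀ u v → orient (f u) ≡ orient (f v) → ¬ Adj G u v)
    × (∀ u v → u ≢ v → orient (f u) ≡ orient (f v) → ¬ Meet (f u) (f v))
    × (∀ u v → orient (f u) ≢ orient (f v) →
         (Adj G u v → Meet (f u) (f v)) × (Meet (f u) (f v) → Adj G u v))

InOpenSquare : Point → ℚ → Point → Set
InOpenSquare c s p =
  (px c < px p) × (px p < px c + s) × (py c < py p) × (py p < py c + s)

UGIRInSquare : ℚ → Graph → Set
UGIRInSquare s G =
  Σ (Fin (n G) → Segment) λ f →
    IsRep sOrient _∈Seg_ G f
    × (∀ v → length (f v) ≡ 1ℚ)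
    × (∃ λ c → ∀ v p → p ∈Seg f v → InOpenSquare c s p)

OrthogonalRayGraph : Graph → Set
OrthogonalRayGraph G = Σ (Fin (n G) → Ray) λ f → IsRep rOrient _∈Ray_ G f

-- Inside an open square of side 1 + ε < 2 with corner b, a unit segment on an
-- axis starts at some a ∈ (b, b + ε) and ends at a + 1 ∈ (b + 1, b + 1 + ε).
-- Hence a perpendicular segment at level ℓ crosses its line inside it iff
-- a ≤ ℓ when ℓ < b + 1, and iff ℓ - 1 ≤ a otherwise: a one-sided threshold on
-- a, which is exactly what a ray pointing down from ℓ (resp. up from ℓ - 1)
-- tests against a perpendicular ray at level a.  So replacing each segment by
-- a ray whose level encodes its start and whose apex encodes its level gives a
-- ray representation; conversely, rays become unit segments by turning the
-- apices of downward (upward) rays into levels in (0, ε) (in (1, 1 + ε)) and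
-- the ray levels into segment starts in (0, ε), all order-preservingly.  Since
-- only the finitely many comparisons matter, all values are replaced by integer
-- ranks, with ties broken by index wherever levels must stay distinct.

module Submission where

open import Defs hiding (sym)
open import Data.Rational using (ℚ; 0ℚ; 1ℚ; _<_; _+_)
open import Function.Bundles using (_⇔_; mk⇔)

open import Data.Bool using (Bool; true; false)
open import Data.Empty using (⊥-elim)
open import Data.Fin using (Fin; toℕ)
open import Data.Fin.Properties using (toℕ<n; toℕ-injective)
open import Data.Fin.Subset using (Subset; _∈_; _⊆_; _⊂_; ∣_∣)
open import Data.Fin.Subset.Properties using (p⊆q⇒∣p∣≤∣q∣; p⊂q⇒∣p∣<∣q∣; ∣p∣≤n)
open import Data.Nat as ℕ using (ℕ; zero; suc; z≤n; s≤s; z<s; s<s; NonZero)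
open import Data.Nat.DivMod using (_%_; [m+kn]%n≡m%n; m<n⇒m%n≡m)
import Data.Nat.Properties as ℕₚ
open import Data.Product using (_×_; _,_; proj₁; proj₂)
open import Data.Rational as ℚ using (_≤_; _-_; _*_; 1/_; Positive)
import Data.Rational.Properties as ℚₚ
open import Data.Rational.Solver using (module +-*-Solver)
open import Data.Vec using (tabulate)
open import Data.Vec.Properties using (lookup∘tabulate; []=⇒lookup; lookup⇒[]=)
open import Function using (id; _∘_)
open import Function.Bundles using (module Equivalence)
open import Function.Properties.Equivalence using () renaming (sym to ⇔-sym; trans to ⇔-trans)
open import Relation.Binary.PropositionalEquality
open import Relation.Nullary using (¬_; Dec; yes; no; does)
open import Relation.Nullary.Decidable using (dec-true)
open import Relation.Unary using (Pred; Decidable)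

open Equivalence using (to; from)

<⇒≱ : ∀ {p q : ℚ} → p < q → ¬ q ≤ p
<⇒≱ p<q q≤p = ℚₚ.<-irrefl refl (ℚₚ.<-≤-trans p<q q≤p)

p+r-r≡p : ∀ p r → (p + r) - r ≡ p
p+r-r≡p = solve 2 (λ p r → (p :+ r) :- r := p) refl
  where open +-*-Solver

p-r+r≡p : ∀ p r → (p - r) + r ≡ p
p-r+r≡p = solve 2 (λ p r → (p :- r) :+ r := p) refl
  where open +-*-Solver

+ʳ-≤⇔ : ∀ {p q} r → p ≤ q ⇔ p + r ≤ q + r
+ʳ-≤⇔ {p} {q} r = mk⇔ (ℚₚ.+-monoˡ-≤ r)
  (subst₂ _≤_ (p+r-r≡p p r) (p+r-r≡p q r) ∘ ℚₚ.+-monoˡ-≤ (ℚ.- r))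

+-cancelʳ-< : ∀ {p q} r → p + r < q + r → p < q
+-cancelʳ-< {p} {q} r =
  subst₂ _<_ (p+r-r≡p p r) (p+r-r≡p q r) ∘ ℚₚ.+-monoˡ-< (ℚ.- r)

p-r≤q⇔p≤q+r : ∀ {p q} r → p - r ≤ q ⇔ p ≤ q + r
p-r≤q⇔p≤q+r {p} {q} r = ⇔-trans (+ʳ-≤⇔ r) (mk⇔ (subst (_≤ q + r) (p-r+r≡p p r))
                                         (subst (_≤ q + r) (sym (p-r+r≡p p r))))

p+q-p≡q : ∀ p q → (p + q) - p ≡ q
p+q-p≡q = solve 2 (λ p q → (p :+ q) :- p := q) refl
  where open +-*-Solver

a+1<b+[1+ε]⇒a<b+1 : ∀ {a b ε} → ε < 1ℚ → a + 1ℚ < b + (1ℚ + ε) → a < b + 1ℚ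
a+1<b+[1+ε]⇒a<b+1 {a} {b} {ε} ε<1 h =
  ℚₚ.<-trans (+-cancelʳ-< 1ℚ (subst (a + 1ℚ <_) regroup h)) (ℚₚ.+-monoʳ-< b ε<1)
  where
  regroup : b + (1ℚ + ε) ≡ (b + ε) + 1ℚ
  regroup = solve 2 (λ b ε → b :+ (con 1ℚ :+ ε) := (b :+ ε) :+ con 1ℚ) refl b ε
    where open +-*-Solver

0<1 : 0ℚ < 1ℚ
0<1 = ℚₚ.positive⁻¹ 1ℚ

p<p+1 : ∀ p → p < p + 1ℚ
p<p+1 p = subst (_< p + 1ℚ) (ℚₚ.+-identityʳ p) (ℚₚ.+-monoʳ-< p 0<1)

_∈[_,_] : ℚ → ℚ → ℚ → Set
q ∈[ l , h ] = l ≤ q × q ≤ h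

_∈⟨_,_⟩ : ℚ → ℚ → ℚ → Set
q ∈⟨ l , h ⟩ = l < q × q < h

low-level : ∀ {b a ℓ} → b < a → ℓ < b + 1ℚ → ℓ ∈[ a , a + 1ℚ ] ⇔ a ≤ ℓ
low-level b<a ℓ<b+1 =
  mk⇔ proj₁ (λ a≤ℓ → a≤ℓ , ℚₚ.<⇒≤ (ℚₚ.<-trans ℓ<b+1 (ℚₚ.+-monoˡ-< 1ℚ b<a)))

high-level : ∀ {b a ℓ} → a < b + 1ℚ → b + 1ℚ ≤ ℓ → ℓ ∈[ a , a + 1ℚ ] ⇔ ℓ ≤ a + 1ℚ
high-level a<b+1 b+1≤ℓ = mk⇔ proj₂ (λ ℓ≤a+1 → ℚₚ.<⇒≤ (ℚₚ.<-≤-trans a<b+1 b+1≤ℓ) , ℓ≤a+1)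

ι : ℕ → ℚ
ι zero    = 0ℚ
ι (suc m) = 1ℚ + ι m

ι-nonNeg : ∀ m → 0ℚ ≤ ι m
ι-nonNeg zero    = ℚₚ.≤-refl
ι-nonNeg (suc m) = ℚₚ.+-mono-≤ (ℚₚ.<⇒≤ 0<1) (ι-nonNeg m)

ι-mono-< : ∀ {m m′} → m ℕ.< m′ → ι m < ι m′
ι-mono-< {zero} {suc m′} z<s = ℚₚ.+-mono-<-≤ 0<1 (ι-nonNeg m′)
ι-mono-< {suc _} (s<s m<m′)   = ℚₚ.+-monoʳ-< 1ℚ (ι-mono-< m<m′)

ι-mono-≤ : ∀ {m m′} → m ℕ.≤ m′ → ι m ≤ ι m′
ι-mono-≤ {m′ = m′} z≤n = ι-nonNeg m′
ι-mono-≤ (s≤s m≤m′)     = ℚₚ.+-monoʳ-≤ 1ℚ (ι-mono-≤ m≤m′)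

ι-cancel-≤ : ∀ {m m′} → ι m ≤ ι m′ → m ℕ.≤ m′
ι-cancel-≤ ιm≤ιm′ = ℕₚ.≮⇒≥ (λ m′<m → <⇒≱ (ι-mono-< m′<m) ιm≤ιm′)

ι-≤⇔ : ∀ {m m′} → m ℕ.≤ m′ ⇔ ι m ≤ ι m′
ι-≤⇔ = mk⇔ ι-mono-≤ ι-cancel-≤

ι-injective : ∀ {m m′} → ι m ≡ ι m′ → m ≡ m′
ι-injective e = ℕₚ.≤-antisym (ι-cancel-≤ (ℚₚ.≤-reflexive e)) (ι-cancel-≤ (ℚₚ.≤-reflexive (sym e)))

ι-positive : ∀ m → 0ℚ < ι (suc m)
ι-positive m = ι-mono-< {0} {suc m} z<s

module Scaled (ε : ℚ) (0<ε : 0ℚ < ε) (B : ℕ) where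

  private instance
    ε-positive : Positive ε
    ε-positive = ℚ.positive 0<ε
    ιB-positive : Positive (ι (suc B))
    ιB-positive = ℚ.positive (ι-positive B)
    ιB-nonZero : ℚ.NonZero (ι (suc B))
    ιB-nonZero = ℚₚ.pos⇒nonZero (ι (suc B))
    1/ιB-positive : Positive (1/ ι (suc B))
    1/ιB-positive = ℚₚ.1/pos⇒pos (ι (suc B))

  δ : ℚ
  δ = ε * 1/ ι (suc B)

  private instance
    δ-positive : Positive δ
    δ-positive = ℚₚ.pos*pos⇒pos ε (1/ ι (suc B))
    δ-nonNeg : ℚ.NonNegative δ
    δ-nonNeg = ℚₚ.pos⇒nonNeg δ

  φ : ℕ → ℚ
  φ m = ι (suc m) * δ

  φ-≤⇔ : ∀ {m m′} → m ℕ.≤ m′ ⇔ φ m ≤ φ m′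
  φ-≤⇔ = ⇔-trans (mk⇔ s≤s ℕ.s≤s⁻¹)
                 (⇔-trans ι-≤⇔ (mk⇔ (ℚₚ.*-monoʳ-≤-nonNeg δ) (ℚₚ.*-cancelʳ-≤-pos δ)))

  φ-injective : ∀ {m m′} → φ m ≡ φ m′ → m ≡ m′
  φ-injective e = ℕₚ.≤-antisym (from φ-≤⇔ (ℚₚ.≤-reflexive e)) (from φ-≤⇔ (ℚₚ.≤-reflexive (sym e)))

  φ-positive : ∀ m → 0ℚ < φ m
  φ-positive m = ℚₚ.positive⁻¹ (φ m) {{ℚₚ.pos*pos⇒pos (ι (suc m)) {{ℚ.positive (ι-positive m)}} δ}}

  φ<ε : ∀ {m} → m ℕ.< B → φ m < ε
  φ<ε {m} m<B = subst (φ m <_) ιB*δ≡ε (ℚₚ.*-monoˡ-<-pos δ (ι-mono-< (s<s m<B)))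
    where
    open ≡-Reasoning
    ιB*δ≡ε : ι (suc B) * δ ≡ ε
    ιB*δ≡ε = begin
      ι (suc B) * (ε * 1/ ι (suc B))   ≡⟨ ℚₚ.*-comm (ι (suc B)) δ ⟩
      ε * 1/ ι (suc B) * ι (suc B)     ≡⟨ ℚₚ.*-assoc ε _ _ ⟩
      ε * (1/ ι (suc B) * ι (suc B))   ≡⟨ cong (ε *_) (ℚₚ.*-inverseˡ (ι (suc B))) ⟩
      ε * 1ℚ                           ≡⟨ ℚₚ.*-identityʳ ε ⟩
      ε                                ∎

subsetOf : ∀ {a m} {P : Pred (Fin m) a} → Decidable P → Subset m
subsetOf P? = tabulate (does ∘ P?)

module _ {a m} {P : Pred (Fin m) a} (P? : Decidable P) where

  ∈-subsetOf⁺ : ∀ {x} → P x → x ∈ subsetOf P?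
  ∈-subsetOf⁺ {x} px = lookup⇒[]= x _ (trans (lookup∘tabulate _ x) (dec-true (P? x) px))

  ∈-subsetOf⁻ : ∀ {x} → x ∈ subsetOf P? → P x
  ∈-subsetOf⁻ {x} x∈ = does≡true⇒ (P? x) (trans (sym (lookup∘tabulate _ x)) ([]=⇒lookup x∈))
    where
    does≡true⇒ : ∀ {A : Set a} (a? : Dec A) → does a? ≡ true → A
    does≡true⇒ (yes a) _ = a

module _ {a b m} {P : Pred (Fin m) a} {Q : Pred (Fin m) b}
         (P? : Decidable P) (Q? : Decidable Q) (P⇒Q : ∀ {x} → P x → Q x) where

  subsetOf-⊆ : subsetOf P? ⊆ subsetOf Q?
  subsetOf-⊆ = ∈-subsetOf⁺ Q? ∘ P⇒Q ∘ ∈-subsetOf⁻ P?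

  subsetOf-⊂ : ∀ {y} → Q y → ¬ P y → subsetOf P? ⊂ subsetOf Q?
  subsetOf-⊂ qy ¬py = subsetOf-⊆ , _ , ∈-subsetOf⁺ Q? qy , ¬py ∘ ∈-subsetOf⁻ P?

module Rank {n : ℕ} (A : Fin n → ℚ) where

  below : (q : ℚ) → Decidable (λ k → A k < q)
  atMost : (q : ℚ) → Decidable (λ k → A k ≤ q)
  below  q k = A k ℚ.<? q
  atMost q k = A k ℚ.≤? q

  #< #≤ : ℚ → ℕ
  #< q = ∣ subsetOf (below q) ∣
  #≤ q = ∣ subsetOf (atMost q) ∣

  ≤⇔#<<#≤ : ∀ i t → A i ≤ t ⇔ #< (A i) ℕ.< #≤ t
  ≤⇔#<<#≤ i t = mk⇔ below⊂atMost atMost⊆below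
    where
    below⊂atMost : A i ≤ t → #< (A i) ℕ.< #≤ t
    below⊂atMost Ai≤t = p⊂q⇒∣p∣<∣q∣ (subsetOf-⊂ (below (A i)) (atMost t)
      (λ Ak<Ai → ℚₚ.<⇒≤ (ℚₚ.<-≤-trans Ak<Ai Ai≤t)) Ai≤t (ℚₚ.<-irrefl refl))
    atMost⊆below : #< (A i) ℕ.< #≤ t → A i ≤ t
    atMost⊆below #<#≤ = ℚₚ.≮⇒≥ λ t<Ai → ℕₚ.<⇒≱ #<#≤ (p⊆q⇒∣p∣≤∣q∣
      (subsetOf-⊆ (atMost t) (below (A i)) (λ Ak≤t → ℚₚ.≤-<-trans Ak≤t t<Ai)))

  ≤⇔#<≤#< : ∀ u i → u ≤ A i ⇔ #< u ℕ.≤ #< (A i)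
  ≤⇔#<≤#< u i = mk⇔ below⊆below below⊂below
    where
    below⊆below : u ≤ A i → #< u ℕ.≤ #< (A i)
    below⊆below u≤Ai = p⊆q⇒∣p∣≤∣q∣
      (subsetOf-⊆ (below u) (below (A i)) (λ Ak<u → ℚₚ.<-≤-trans Ak<u u≤Ai))
    below⊂below : #< u ℕ.≤ #< (A i) → u ≤ A i
    below⊂below #≤# = ℚₚ.≮⇒≥ λ Ai<u → ℕₚ.<⇒≱ (p⊂q⇒∣p∣<∣q∣ (subsetOf-⊂ (below (A i)) (below u)
      (λ Ak<Ai → ℚₚ.<-trans Ak<Ai Ai<u) Ai<u (ℚₚ.<-irrefl refl))) #≤#

  #<-bound : ∀ q → #< q ℕ.≤ n
  #<-bound q = ∣p∣≤n (subsetOf (below q))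

  #≤-bound : ∀ t → #≤ t ℕ.≤ n
  #≤-bound t = ∣p∣≤n (subsetOf (atMost t))

module _ {k a b r : ℕ} (r<k : r ℕ.< k) where
  open ℕₚ.≤-Reasoning

  *+suc≤*⇔< : k ℕ.* a ℕ.+ suc r ℕ.≤ k ℕ.* b ⇔ a ℕ.< b
  *+suc≤*⇔< = mk⇔ to′ from′
    where
    from′ : a ℕ.< b → k ℕ.* a ℕ.+ suc r ℕ.≤ k ℕ.* b
    from′ a<b = begin
      k ℕ.* a ℕ.+ suc r  ≤⟨ ℕₚ.+-monoʳ-≤ (k ℕ.* a) r<k ⟩
      k ℕ.* a ℕ.+ k      ≡⟨ ℕₚ.+-comm (k ℕ.* a) k ⟩
      k ℕ.+ k ℕ.* a      ≡⟨ ℕₚ.*-suc k a ⟨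
      k ℕ.* suc a        ≤⟨ ℕₚ.*-monoʳ-≤ k a<b ⟩
      k ℕ.* b            ∎
    to′ : k ℕ.* a ℕ.+ suc r ℕ.≤ k ℕ.* b → a ℕ.< b
    to′ h = ℕₚ.≰⇒> λ b≤a → ℕₚ.<⇒≱ (begin-strict
      k ℕ.* b            ≤⟨ ℕₚ.*-monoʳ-≤ k b≤a ⟩
      k ℕ.* a            <⟨ ℕₚ.m<m+n (k ℕ.* a) z<s ⟩
      k ℕ.* a ℕ.+ suc r  ∎) h

module _ {k a b r : ℕ} (r<k : r ℕ.< k) where

  *≤*+⇔≤ : k ℕ.* a ℕ.≤ k ℕ.* b ℕ.+ r ⇔ a ℕ.≤ b
  *≤*+⇔≤ = mk⇔ to′ from′
    where
    from′ : a ℕ.≤ b → k ℕ.* a ℕ.≤ k ℕ.* b ℕ.+ r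
    from′ a≤b = ℕₚ.≤-trans (ℕₚ.*-monoʳ-≤ k a≤b) (ℕₚ.m≤m+n (k ℕ.* b) r)
    to′ : k ℕ.* a ℕ.≤ k ℕ.* b ℕ.+ r → a ℕ.≤ b
    to′ h = ℕₚ.≮⇒≥ λ b<a → ℕₚ.<⇒≱ (ℕₚ.+-monoʳ-< (k ℕ.* b) (ℕₚ.n<1+n r))
      (ℕₚ.≤-trans (from (*+suc≤*⇔< {a = b} {b = a} r<k) b<a) h)

*+-remainder : ∀ k {a r} .{{_ : NonZero k}} → r ℕ.< k → (k ℕ.* a ℕ.+ r) % k ≡ r
*+-remainder k {a} {r} r<k = begin
  (k ℕ.* a ℕ.+ r) % k  ≡⟨ cong (_% k) (ℕₚ.+-comm (k ℕ.* a) r) ⟩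
  (r ℕ.+ k ℕ.* a) % k  ≡⟨ cong (λ x → (r ℕ.+ x) % k) (ℕₚ.*-comm k a) ⟩
  (r ℕ.+ a ℕ.* k) % k  ≡⟨ [m+kn]%n≡m%n r a k ⟩
  r % k                ≡⟨ m<n⇒m%n≡m r<k ⟩
  r                    ∎
  where open ≡-Reasoning

*+-injectiveʳ : ∀ k {a b r s} .{{_ : NonZero k}} → r ℕ.< k → s ℕ.< k →
                k ℕ.* a ℕ.+ r ≡ k ℕ.* b ℕ.+ s → r ≡ s
*+-injectiveʳ k r<k s<k e =
  trans (sym (*+-remainder k r<k)) (trans (cong (_% k) e) (*+-remainder k s<k))

-- Multiplying a rank by K = n + 1 leaves room for a remainder in 1 … n that
-- separates the codes of distinct indices without disturbing the comparisons.
module Codes {n : ℕ} (A : Fin n → ℚ) where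
  open Rank A

  K : ℕ
  K = suc n

  index<K : (i : Fin n) → toℕ i ℕ.< K
  index<K i = ℕₚ.m<n⇒m<1+n (toℕ<n i)

  suc-index<K : (i : Fin n) → suc (toℕ i) ℕ.< K
  suc-index<K i = s<s (toℕ<n i)

  module ByKey where

    key : Fin n → ℕ
    key i = K ℕ.* #< (A i) ℕ.+ suc (toℕ i)

    down up : ℚ → ℕ
    down t = K ℕ.* #≤ t
    up   u = K ℕ.* #< u

    key≤down⇔ : ∀ i t → key i ℕ.≤ down t ⇔ A i ≤ t
    key≤down⇔ i t = ⇔-trans (*+suc≤*⇔< (index<K i)) (⇔-sym (≤⇔#<<#≤ i t))

    up≤key⇔ : ∀ u i → up u ℕ.≤ key i ⇔ u ≤ A i
    up≤key⇔ u i = ⇔-trans (*≤*+⇔≤ (suc-index<K i)) (⇔-sym (≤⇔#<≤#< u i))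

    key-injective : ∀ i j → key i ≡ key j → i ≡ j
    key-injective i j e =
      toℕ-injective (ℕₚ.suc-injective (*+-injectiveʳ K (suc-index<K i) (suc-index<K j) e))

  module ByThreshold where

    key : Fin n → ℕ
    key i = K ℕ.* suc (#< (A i))

    down up : ℚ → Fin n → ℕ
    down t j = K ℕ.* #≤ t ℕ.+ suc (toℕ j)
    up   u j = K ℕ.* #< u ℕ.+ suc (toℕ j)

    key≤down⇔ : ∀ i t j → key i ℕ.≤ down t j ⇔ A i ≤ t
    key≤down⇔ i t j = ⇔-trans (*≤*+⇔≤ (suc-index<K j)) (⇔-sym (≤⇔#<<#≤ i t))

    up≤key⇔ : ∀ u j i → up u j ℕ.≤ key i ⇔ u ≤ A i
    up≤key⇔ u j i = ⇔-trans (*+suc≤*⇔< (index<K j))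
                     (⇔-trans (mk⇔ ℕ.s≤s⁻¹ s≤s) (⇔-sym (≤⇔#<≤#< u i)))

    down-injective : ∀ t t′ j j′ → down t j ≡ down t′ j′ → j ≡ j′
    down-injective t t′ j j′ e =
      toℕ-injective (ℕₚ.suc-injective (*+-injectiveʳ K (suc-index<K j) (suc-index<K j′) e))

    up-injective : ∀ u u′ j j′ → up u j ≡ up u′ j′ → j ≡ j′
    up-injective u u′ j j′ e =
      toℕ-injective (ℕₚ.suc-injective (*+-injectiveʳ K (suc-index<K j) (suc-index<K j′) e))

    key-bound : ∀ i → key i ℕ.≤ K ℕ.* K
    key-bound i = ℕₚ.*-monoʳ-≤ K (s≤s (#<-bound (A i)))

    down-bound : ∀ t j → down t j ℕ.≤ K ℕ.* K
    down-bound t j = from (*+suc≤*⇔< (index<K j)) (s≤s (#≤-bound t))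

    up-bound : ∀ u j → up u j ℕ.≤ K ℕ.* K
    up-bound u j = from (*+suc≤*⇔< (index<K j)) (s≤s (#<-bound u))

flip : Orient → Orient
flip hor = ver
flip ver = hor

≢⇒≡flip : ∀ {o o′} → o ≢ o′ → o′ ≡ flip o
≢⇒≡flip {hor} {hor} o≢o′ = ⊥-elim (o≢o′ refl)
≢⇒≡flip {hor} {ver} _    = refl
≢⇒≡flip {ver} {hor} _    = refl
≢⇒≡flip {ver} {ver} o≢o′ = ⊥-elim (o≢o′ refl)

perpendicular-coordinates : ∀ {o o′} → o′ ≡ flip o → ∀ p →
                            across o′ p ≡ along o p × along o′ p ≡ across o p
perpendicular-coordinates {hor} refl p = refl , refl
perpendicular-coordinates {ver} refl p = refl , refl

point : Orient → ℚ → ℚ → Point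
point hor x y = ⟨ x , y ⟩
point ver x y = ⟨ y , x ⟩

along-point : ∀ o x y → along o (point o x y) ≡ x
along-point hor x y = refl
along-point ver x y = refl

across-point : ∀ o x y → across o (point o x y) ≡ y
across-point hor x y = refl
across-point ver x y = refl

InOpenSquare⇒along : ∀ o {c s p} → InOpenSquare c s p → along o p ∈⟨ along o c , along o c + s ⟩
InOpenSquare⇒along hor (x₁ , x₂ , _ , _) = x₁ , x₂
InOpenSquare⇒along ver (_ , _ , y₁ , y₂) = y₁ , y₂

∈⟨0,s⟩⇒InOpenSquare : ∀ o {s p} → along o p ∈⟨ 0ℚ , s ⟩ → across o p ∈⟨ 0ℚ , s ⟩ →
                      InOpenSquare ⟨ 0ℚ , 0ℚ ⟩ s p
∈⟨0,s⟩⇒InOpenSquare o {s} along∈ across∈ = square o along∈ across∈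
  where
  <0+s : ∀ {q} → q < s → q < 0ℚ + s
  <0+s = subst (_ <_) (sym (ℚₚ.+-identityˡ s))
  square : ∀ o {p} → along o p ∈⟨ 0ℚ , s ⟩ → across o p ∈⟨ 0ℚ , s ⟩ → InOpenSquare ⟨ 0ℚ , 0ℚ ⟩ s p
  square hor (x₁ , x₂) (y₁ , y₂) = x₁ , <0+s x₂ , y₁ , <0+s y₂
  square ver (y₁ , y₂) (x₁ , x₂) = x₁ , <0+s x₂ , y₁ , <0+s y₂

Covers : Bool → ℚ → ℚ → Set
Covers true  s q = s ≤ q
Covers false s q = q ≤ s

record AxisParallel {Obj : Set} (orient : Obj → Orient) (_∈ᵒ_ : Point → Obj → Set) : Set₁ where
  field
    level : Obj → ℚ
    Span  : Obj → ℚ → Set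
    ∈⇔    : ∀ {p a} → p ∈ᵒ a ⇔ (across (orient a) p ≡ level a × Span a (along (orient a) p))

  point-∈ : ∀ {a x} → Span a x → point (orient a) x (level a) ∈ᵒ a
  point-∈ {a} {x} s =
    from ∈⇔ ( across-point (orient a) x (level a)
            , subst (Span a) (sym (along-point (orient a) x (level a))) s)

  meet⇒level≡ : ∀ {a b} → orient a ≡ orient b → Meet orient _∈ᵒ_ a b → level a ≡ level b
  meet⇒level≡ o≡ (p , p∈a , p∈b) =
    trans (sym (proj₁ (to ∈⇔ p∈a))) (trans (cong (λ o → across o p) o≡) (proj₁ (to ∈⇔ p∈b)))

  meet⇔spans : ∀ {a b} → orient b ≡ flip (orient a) →
               Meet orient _∈ᵒ_ a b ⇔ (Span a (level b) × Span b (level a))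
  meet⇔spans {a} {b} perp = mk⇔ to′ from′
    where
    to′ : Meet orient _∈ᵒ_ a b → Span a (level b) × Span b (level a)
    to′ (p , p∈a , p∈b) with to ∈⇔ p∈a | to ∈⇔ p∈b | perpendicular-coordinates perp p
    ... | (on-a , span-a) | (on-b , span-b) | (across≡ , along≡) =
      subst (Span a) (trans (sym across≡) on-b) span-a ,
      subst (Span b) (trans along≡ on-a) span-b
    from′ : Span a (level b) × Span b (level a) → Meet orient _∈ᵒ_ a b
    from′ (span-a , span-b) =
      p , point-∈ span-a , from ∈⇔ (on-b , subst (Span b) (sym along≡) span-b)
      where
      p = point (orient a) (level b) (level a)
      on-b : across (orient b) p ≡ level b
      on-b = trans (proj₁ (perpendicular-coordinates perp p))
                   (along-point (orient a) (level b) (level a))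
      along≡ : along (orient b) p ≡ level a
      along≡ = trans (proj₂ (perpendicular-coordinates perp p))
                     (across-point (orient a) (level b) (level a))

segments : AxisParallel sOrient _∈Seg_
segments = record { level = sLevel ; Span = λ s q → q ∈[ lo s , hi s ] ; ∈⇔ = mk⇔ id id }

rays : AxisParallel rOrient _∈Ray_
rays = record
  { level = rLevel
  ; Span  = λ r → Covers (positive r) (start r)
  ; ∈⇔    = λ {p} {r} → ∈Ray⇔ p r
  }
  where
  ∈Ray⇔ : ∀ p r → p ∈Ray r ⇔
          (across (rOrient r) p ≡ rLevel r × Covers (positive r) (start r) (along (rOrient r) p))
  ∈Ray⇔ p record { positive = true }  = mk⇔ id id
  ∈Ray⇔ p record { positive = false } = mk⇔ id id

-- Meeting is decided by the two crossing conditions, so a representation can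
-- be rebuilt from one whose spans and levels trade places.
module _ {Obj₁ Obj₂ : Set} {o₁ : Obj₁ → Orient} {o₂ : Obj₂ → Orient}
         {_∈₁_ : Point → Obj₁ → Set} {_∈₂_ : Point → Obj₂ → Set}
         (X₁ : AxisParallel o₁ _∈₁_) (X₂ : AxisParallel o₂ _∈₂_) where
  private
    module X₁ = AxisParallel X₁
    module X₂ = AxisParallel X₂

  dual-IsRep : ∀ {G} {f : Fin (n G) → Obj₁} {g : Fin (n G) → Obj₂} →
    (∀ i → o₂ (g i) ≡ o₁ (f i)) →
    (∀ i j → X₂.level (g i) ≡ X₂.level (g j) → i ≡ j) →
    (∀ i j → o₁ (f j) ≡ flip (o₁ (f i)) →
       X₁.Span (f i) (X₁.level (f j)) ⇔ X₂.Span (g j) (X₂.level (g i))) →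
    IsRep o₁ _∈₁_ G f → IsRep o₂ _∈₂_ G g
  dual-IsRep {G} {f} {g} o≡ level-injective spans⇔ (bipartite , disjoint , meets) =
    bipartite′ , disjoint′ , meets′
    where
    same-orient : ∀ {u v} → o₂ (g u) ≡ o₂ (g v) → o₁ (f u) ≡ o₁ (f v)
    same-orient {u} {v} e = trans (sym (o≡ u)) (trans e (o≡ v))

    other-orient : ∀ {u v} → o₂ (g u) ≢ o₂ (g v) → o₁ (f u) ≢ o₁ (f v)
    other-orient {u} {v} ne e = ne (trans (o≡ u) (trans e (sym (o≡ v))))

    bipartite′ : ∀ u v → o₂ (g u) ≡ o₂ (g v) → ¬ Adj G u v
    bipartite′ u v = bipartite u v ∘ same-orient

    disjoint′ : ∀ u v → u ≢ v → o₂ (g u) ≡ o₂ (g v) → ¬ Meet o₂ _∈₂_ (g u) (g v)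
    disjoint′ u v u≢v e = u≢v ∘ level-injective u v ∘ X₂.meet⇒level≡ e

    meet⇔meet : ∀ u v → o₁ (f u) ≢ o₁ (f v) → Meet o₁ _∈₁_ (f u) (f v) ⇔ Meet o₂ _∈₂_ (g u) (g v)
    meet⇔meet u v ne = mk⇔
      (λ m → let (s , t) = to (X₁.meet⇔spans perpᵤᵥ) m in
             from (X₂.meet⇔spans perp₂) (to (spans⇔ v u perpᵥᵤ) t , to (spans⇔ u v perpᵤᵥ) s))
      (λ m → let (s , t) = to (X₂.meet⇔spans perp₂) m in
             from (X₁.meet⇔spans perpᵤᵥ) (from (spans⇔ u v perpᵤᵥ) t , from (spans⇔ v u perpᵥᵤ) s))
      where
      perpᵤᵥ = ≢⇒≡flip ne
      perpᵥᵤ = ≢⇒≡flip (ne ∘ sym)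
      perp₂ = trans (o≡ v) (trans perpᵤᵥ (cong flip (sym (o≡ u))))

    meets′ : ∀ u v → o₂ (g u) ≢ o₂ (g v) →
             (Adj G u v → Meet o₂ _∈₂_ (g u) (g v)) × (Meet o₂ _∈₂_ (g u) (g v) → Adj G u v)
    meets′ u v ne =
      let (adj⇒meet , meet⇒adj) = meets u v (other-orient ne)
          meet⇔meet′ = meet⇔meet u v (other-orient ne)
      in to meet⇔meet′ ∘ adj⇒meet , meet⇒adj ∘ from meet⇔meet′

module RaysFromSegments
  (ε : ℚ) (ε<1 : ε < 1ℚ) (G : Graph) (f : Fin (n G) → Segment)
  (unit : ∀ v → length (f v) ≡ 1ℚ) (c : Point)
  (inside : ∀ v p → p ∈Seg f v → InOpenSquare c (1ℚ + ε) p) where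

  o : Fin (n G) → Orient
  o = sOrient ∘ f

  a ℓ : Fin (n G) → ℚ
  a = lo ∘ f
  ℓ = sLevel ∘ f

  open Codes a
  open ByKey

  hi≡a+1 : ∀ i → hi (f i) ≡ a i + 1ℚ
  hi≡a+1 i = trans (sym (p-r+r≡p (hi (f i)) (a i)))
                   (trans (cong (_+ a i) (unit i)) (ℚₚ.+-comm 1ℚ (a i)))

  corner : Fin (n G) → ℚ
  corner i = along (o i) c

  span-inside : ∀ i {x} → x ∈[ a i , hi (f i) ] → x ∈⟨ corner i , corner i + (1ℚ + ε) ⟩
  span-inside i {x} x∈ = subst (_∈⟨ corner i , corner i + (1ℚ + ε) ⟩) (along-point (o i) x (ℓ i))
    (InOpenSquare⇒along (o i) (inside i _ (AxisParallel.point-∈ segments {f i} x∈)))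

  corner<a : ∀ i → corner i < a i
  corner<a i = proj₁ (span-inside i (ℚₚ.≤-refl , lo≤hi (f i)))

  a<corner+1 : ∀ i → a i < corner i + 1ℚ
  a<corner+1 i = a+1<b+[1+ε]⇒a<b+1 {b = corner i} ε<1
    (subst (_< corner i + (1ℚ + ε)) (hi≡a+1 i) (proj₂ (span-inside i (lo≤hi (f i) , ℚₚ.≤-refl))))

  high? : ∀ j → Dec (across (o j) c + 1ℚ ≤ ℓ j)
  high? j = across (o j) c + 1ℚ ℚ.≤? ℓ j

  start-from : ∀ {X : Set} → Dec X → ℚ → ℚ
  start-from (yes _) x = ι (up (x - 1ℚ))
  start-from (no _)  x = ι (down x)

  ray : Fin (n G) → Ray
  ray j = record
    { rOrient  = o j
    ; rLevel   = ι (key j)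
    ; start    = start-from (high? j) (ℓ j)
    ; positive = does (high? j)
    }

  crossing-at : ∀ i {j b} → b ≡ corner i → (d : Dec (b + 1ℚ ≤ ℓ j)) →
                ℓ j ∈[ a i , a i + 1ℚ ] ⇔ Covers (does d) (start-from d (ℓ j)) (ι (key i))
  crossing-at i {j} refl (yes high) =
    ⇔-trans (high-level {corner i} (a<corner+1 i) high)
      (⇔-trans (⇔-sym (p-r≤q⇔p≤q+r 1ℚ)) (⇔-trans (⇔-sym (up≤key⇔ (ℓ j - 1ℚ) i)) ι-≤⇔))
  crossing-at i {j} refl (no low) =
    ⇔-trans (low-level {corner i} (corner<a i) (ℚₚ.≰⇒> low))
      (⇔-trans (⇔-sym (key≤down⇔ i (ℓ j))) ι-≤⇔)

  crossing : ∀ i j → o j ≡ flip (o i) →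
             ℓ j ∈[ a i , hi (f i) ] ⇔ Covers (does (high? j)) (start-from (high? j) (ℓ j)) (ι (key i))
  crossing i j perp =
    subst (λ h → ℓ j ∈[ a i , h ] ⇔ Covers (does (high? j)) (start-from (high? j) (ℓ j)) (ι (key i)))
      (sym (hi≡a+1 i)) (crossing-at i (proj₁ (perpendicular-coordinates perp c)) (high? j))

  represents : IsRep sOrient _∈Seg_ G f → IsRep rOrient _∈Ray_ G ray
  represents = dual-IsRep segments rays {G} {f} {ray} (λ _ → refl)
    (λ i j → key-injective i j ∘ ι-injective) crossing

module SegmentsFromRays
  (ε : ℚ) (0<ε : 0ℚ < ε) (ε<1 : ε < 1ℚ) (G : Graph) (g : Fin (n G) → Ray) where

  A : Fin (n G) → ℚ
  A = rLevel ∘ g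

  open Codes A
  open ByThreshold
  open Scaled ε 0<ε (suc (K ℕ.* K))

  φ<1 : ∀ {m} → m ℕ.≤ K ℕ.* K → φ m < 1ℚ
  φ<1 m≤ = ℚₚ.<-trans (φ<ε (s≤s m≤)) ε<1

  ε<1+ε : ε < 1ℚ + ε
  ε<1+ε = subst (_< 1ℚ + ε) (ℚₚ.+-identityˡ ε) (ℚₚ.+-monoˡ-< ε 0<1)

  +1<1+ε : ∀ {x} → x < ε → x + 1ℚ < 1ℚ + ε
  +1<1+ε {x} x<ε = subst (x + 1ℚ <_) (ℚₚ.+-comm ε 1ℚ) (ℚₚ.+-monoˡ-< 1ℚ x<ε)

  1≤φ+1 : ∀ m → 1ℚ ≤ φ m + 1ℚ
  1≤φ+1 m = ℚₚ.+-monoˡ-≤ 1ℚ (ℚₚ.<⇒≤ (φ-positive m))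

  position : Fin (n G) → ℚ
  position i = φ (key i)

  level-of : Bool → ℚ → Fin (n G) → ℚ
  level-of true  s j = φ (up s j) + 1ℚ
  level-of false s j = φ (down s j)

  segment : Fin (n G) → Segment
  segment j = record
    { sOrient = rOrient (g j)
    ; sLevel  = level-of (positive (g j)) (start (g j)) j
    ; lo      = position j
    ; hi      = position j + 1ℚ
    ; lo≤hi   = ℚₚ.<⇒≤ (p<p+1 (position j))
    }

  unit-length : ∀ j → length (segment j) ≡ 1ℚ
  unit-length j = p+q-p≡q (position j) 1ℚ

  crossing-at : ∀ b s i j → Covers b s (A j) ⇔ level-of b s i ∈[ position j , position j + 1ℚ ]
  crossing-at true s i j =
    ⇔-trans (⇔-sym (up≤key⇔ s i j))
      (⇔-trans φ-≤⇔ (⇔-trans (+ʳ-≤⇔ 1ℚ)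
        (⇔-sym (high-level {0ℚ} (φ<1 (key-bound j)) (1≤φ+1 (up s i))))))
  crossing-at false s i j =
    ⇔-trans (⇔-sym (key≤down⇔ j s i))
      (⇔-trans φ-≤⇔ (⇔-sym (low-level {0ℚ} (φ-positive (key j)) (φ<1 (down-bound s i)))))

  crossing : ∀ i j → rOrient (g j) ≡ flip (rOrient (g i)) →
             Covers (positive (g i)) (start (g i)) (A j) ⇔
             level-of (positive (g i)) (start (g i)) i ∈[ position j , position j + 1ℚ ]
  crossing i j _ = crossing-at (positive (g i)) (start (g i)) i j

  down<up : ∀ s s′ i j → level-of false s i < level-of true s′ j
  down<up s s′ i j = ℚₚ.<-≤-trans (φ<1 (down-bound s i)) (1≤φ+1 (up s′ j))

  level-of-injective : ∀ b b′ s s′ i j → level-of b s i ≡ level-of b′ s′ j → i ≡ j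
  level-of-injective true true s s′ i j e =
    up-injective s s′ i j (φ-injective (ℚₚ.≤-antisym (from (+ʳ-≤⇔ 1ℚ) (ℚₚ.≤-reflexive e))
                                                     (from (+ʳ-≤⇔ 1ℚ) (ℚₚ.≤-reflexive (sym e)))))
  level-of-injective false false s s′ i j e = down-injective s s′ i j (φ-injective e)
  level-of-injective false true  s s′ i j e = ⊥-elim (ℚₚ.<-irrefl e (down<up s s′ i j))
  level-of-injective true  false s s′ i j e = ⊥-elim (ℚₚ.<-irrefl (sym e) (down<up s′ s j i))

  level-inside : ∀ b s j → level-of b s j ∈⟨ 0ℚ , 1ℚ + ε ⟩
  level-inside true s j =
    ℚₚ.<-≤-trans 0<1 (1≤φ+1 (up s j)) , +1<1+ε (φ<ε (s≤s (up-bound s j)))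
  level-inside false s j =
    φ-positive (down s j) , ℚₚ.<-trans (φ<ε (s≤s (down-bound s j))) ε<1+ε

  inside : ∀ v p → p ∈Seg segment v → InOpenSquare ⟨ 0ℚ , 0ℚ ⟩ (1ℚ + ε) p
  inside v p (on-line , lo≤ , ≤hi) = ∈⟨0,s⟩⇒InOpenSquare (rOrient (g v))
    (ℚₚ.<-≤-trans (φ-positive (key v)) lo≤ , ℚₚ.≤-<-trans ≤hi (+1<1+ε (φ<ε (s≤s (key-bound v)))))
    (subst (_∈⟨ 0ℚ , 1ℚ + ε ⟩) (sym on-line) (level-inside (positive (g v)) (start (g v)) v))

  represents : IsRep rOrient _∈Ray_ G g → IsRep sOrient _∈Seg_ G segment
  represents = dual-IsRep rays segments {G} {g} {segment} (λ _ → refl)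
    (λ i j → level-of-injective (positive (g i)) (positive (g j)) (start (g i)) (start (g j)) i j)
    crossing

theorem1 : (ε : ℚ) → 0ℚ < ε → ε < 1ℚ → (G : Graph) →
    UGIRInSquare (1ℚ + ε) G ⇔ OrthogonalRayGraph G
theorem1 ε 0<ε ε<1 G = mk⇔ rays-from-segments segments-from-rays
  where
  rays-from-segments : UGIRInSquare (1ℚ + ε) G → OrthogonalRayGraph G
  rays-from-segments (f , rep , unit , c , inside) = ray , represents rep
    where open RaysFromSegments ε ε<1 G f unit c inside

  segments-from-rays : OrthogonalRayGraph G → UGIRInSquare (1ℚ + ε) G
  segments-from-rays (g , rep) = segment , represents rep , unit-length , ⟨ 0ℚ , 0ℚ ⟩ , inside
    where open SegmentsFromRays ε 0<ε ε<1 G g
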